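{- In each of the categories $\mathbf{SiStGrphs}$, $\mathbf{SiLlGrphs}$ and $\mathbf{SiLlStGrphs}$, a morphism $f:G\to H$ is an epimorphism if and only if its restriction $f_V:V(G)\to V(H)$ to vertex sets is surjective, and $f$ is a monomorphism if and only if $f_V:V(G)\to V(H)$ is injective.
   Context: A (conceptual) graph $G$ consists of a set $P(G)$ of parts, a distinguished subset $V(G)\subseteq P(G)$ of vertices, and an incidence map $\partial_G:P(G)\to V(G)\underline{\times}V(G)$ into the set of unordered pairs of vertices (the pair of $u,v$ written $u\_v$; $u=v$ allowed), such that $\partial_G(v)=v\_v$ for every vertex $v$. The edges are $E(G)=P(G)\setminus V(G)$; an edge with incidence $u\_u$ is a loop. Sets may be infinite; the empty graph is allowed. A graph is simple if for every unordered pair $u\_v$ there is at most one edge with that incidence, and loopless if it has no loops. A graph morphism $f:G\to H$ is a function $f:P(G)\to P(H)$ with $f(V(G))\subseteq V(H)$ such that $\partial_H(f(e))=f(x)\_f(y)$ whenever $\partial_G(e)=x\_y$; it is strict if moreover $f(E(G))\subseteq E(H)$. Categories: $\mathbf{SiStGrphs}$ (simple graphs, strict morphisms), $\mathbf{SiLlGrphs}$ (simple loopless graphs, all graph morphisms), $\mathbf{SiLlStGrphs}$ (simple loopless graphs, strict morphisms). -}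

module Defs where

open import Level using (Level; _⊔_) renaming (suc to lsuc)
open import Data.Product using (Σ; ∃; _×_; _,_; proj₁; proj₂)
open import Data.Sum using (_⊎_; inj₁; inj₂)
open import Data.Unit.Polymorphic using (⊤)
open import Data.Empty.Polymorphic using (⊥)
open import Relation.Nullary using (¬_)
open import Relation.Binary.PropositionalEquality using (_≡_)

-- Unordered pairs u_v are represented by an ordered representative (u , v);
-- two representatives denote the same unordered pair iff they agree up to swap.
_≐_ : ∀ {ℓ} {A : Set ℓ} → A × A → A × A → Set ℓ
(u , v) ≐ (x , y) = ((u ≡ x) × (v ≡ y)) ⊎ ((u ≡ y) × (v ≡ x))

-- A (conceptual) graph: the set of parts P(G) is V(G) ⊎ E(G) (disjoint union of
-- the distinguished subset of vertices and its complement, the edges).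
record Graph (ℓ : Level) : Set (lsuc ℓ) where
  field
    V    : Set ℓ
    E    : Set ℓ
    ends : E → V × V

  P : Set ℓ
  P = V ⊎ E

  ∂ : P → V × V
  ∂ (inj₁ v) = v , v
  ∂ (inj₂ e) = ends e

open Graph public

IsVertex : ∀ {ℓ} (G : Graph ℓ) → P G → Set ℓ
IsVertex G (inj₁ _) = ⊤
IsVertex G (inj₂ _) = ⊥

IsEdge : ∀ {ℓ} (G : Graph ℓ) → P G → Set ℓ
IsEdge G (inj₁ _) = ⊥
IsEdge G (inj₂ _) = ⊤

map² : ∀ {a b} {A : Set a} {B : Set b} → (A → B) → A × A → B × B
map² f (x , y) = f x , f y

record Hom {ℓ} (G H : Graph ℓ) : Set ℓ where
  field
    fun      : P G → P H
    fV       : V G → V H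
    fV-ok    : ∀ v → fun (inj₁ v) ≡ inj₁ (fV v)
    incident : ∀ p → ∂ H (fun p) ≐ map² fV (∂ G p)

open Hom public

IsStrict : ∀ {ℓ} {G H : Graph ℓ} → Hom G H → Set ℓ
IsStrict {G = G} {H} f = ∀ e → IsEdge H (fun f (inj₂ e))

IsSimple : ∀ {ℓ} → Graph ℓ → Set ℓ
IsSimple G = ∀ e e′ → ends G e ≐ ends G e′ → e ≡ e′

IsLoopless : ∀ {ℓ} → Graph ℓ → Set ℓ
IsLoopless G = ∀ e → ¬ (proj₁ (ends G e) ≡ proj₂ (ends G e))

data Cat : Set where
  SiStGrphs SiLlGrphs SiLlStGrphs : Cat

Obj : ∀ {ℓ} → Cat → Graph ℓ → Set ℓ
Obj SiStGrphs   G = IsSimple G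
Obj SiLlGrphs   G = IsSimple G × IsLoopless G
Obj SiLlStGrphs G = IsSimple G × IsLoopless G

Mor : ∀ {ℓ} (C : Cat) {G H : Graph ℓ} → Hom G H → Set ℓ
Mor SiStGrphs   f = IsStrict f
Mor SiLlGrphs   f = ⊤
Mor SiLlStGrphs f = IsStrict f

_≈_ : ∀ {ℓ} {G H : Graph ℓ} → Hom G H → Hom G H → Set ℓ
f ≈ g = ∀ p → fun f p ≡ fun g p

_⊚_ : ∀ {ℓ} {G H K : Graph ℓ} → Hom H K → Hom G H → P G → P K
(g ⊚ f) p = fun g (fun f p)

IsEpi : ∀ {ℓ} (C : Cat) {G H : Graph ℓ} → Hom G H → Set (lsuc ℓ)
IsEpi {ℓ} C {G} {H} f =
  (K : Graph ℓ) → Obj C K → (g h : Hom H K) → Mor C g → Mor C h →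
  (∀ p → (g ⊚ f) p ≡ (h ⊚ f) p) → g ≈ h

IsMono : ∀ {ℓ} (C : Cat) {G H : Graph ℓ} → Hom G H → Set (lsuc ℓ)
IsMono {ℓ} C {G} {H} f =
  (K : Graph ℓ) → Obj C K → (g h : Hom K G) → Mor C g → Mor C h →
  (∀ p → (f ⊚ g) p ≡ (f ⊚ h) p) → g ≈ h

Surjective : ∀ {a b} {A : Set a} {B : Set b} → (A → B) → Set (a ⊔ b)
Surjective {A = A} f = ∀ y → Σ A (λ x → f x ≡ y)

Injective : ∀ {a b} {A : Set a} {B : Set b} → (A → B) → Set (a ⊔ b)
Injective f = ∀ x y → f x ≡ f y → x ≡ y

-- A morphism into a simple graph is determined by its vertex map: an edge's image is pinned down
-- by its incidence, except that a vertex and a loop at it share one, which strictness (both images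
-- are edges) or looplessness rules out.  Hence surjective / injective vertex maps give epis / monos.
-- Conversely, maps out of the one-vertex graph detect injectivity, and for surjectivity one
-- doubles every vertex outside the image (together with the edges touching such vertices): the
-- inclusion and the map onto the copies agree after f, so if f is epi they agree everywhere, which
-- forces every vertex into the image.  Deciding membership in the image is the only classical step.
module Submission where

open import Defs
open import Level using (Level)
open import Data.Product using (_×_)
open import Function.Bundles using (_⇔_)
open import Axiom.ExcludedMiddle using (ExcludedMiddle)

open import Data.Bool using (Bool; true; false; T; _∨_)
open import Data.Bool.Properties using (T-∨; T-irrelevant)
open import Data.Empty using (⊥-elim)
open import Data.Product using (Σ; _,_; proj₁; proj₂)
open import Data.Sum using (_⊎_; inj₁; inj₂; [_,_]′)
open import Data.Sum.Properties using (inj₁-injective; inj₂-injective)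
open import Data.Unit.Polymorphic using (⊤; tt)
open import Data.Empty.Polymorphic using (⊥)
open import Function.Base using (_∘_)
open import Function.Bundles using (mk⇔; Equivalence)
open import Relation.Nullary using (¬_; Dec; yes; no)
open import Relation.Nullary.Decidable using (T?; isYes; toWitness; fromWitness; decidable-stable)
open import Relation.Binary.PropositionalEquality using (_≡_; refl; sym; trans; cong)

private
  variable
    ℓ : Level
    A B : Set ℓ

≐-sym : {p q : A × A} → p ≐ q → q ≐ p
≐-sym (inj₁ (refl , refl)) = inj₁ (refl , refl)
≐-sym (inj₂ (refl , refl)) = inj₂ (refl , refl)

≐-trans : {p q r : A × A} → p ≐ q → q ≐ r → p ≐ r
≐-trans (inj₁ (refl , refl)) q≐r                  = q≐r
≐-trans (inj₂ (refl , refl)) (inj₁ (refl , refl)) = inj₂ (refl , refl)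
≐-trans (inj₂ (refl , refl)) (inj₂ (refl , refl)) = inj₁ (refl , refl)

≐-diagonal : {w x y : A} → (w , w) ≐ (x , y) → (w ≡ x) × (w ≡ y)
≐-diagonal (inj₁ (w≡x , w≡y)) = w≡x , w≡y
≐-diagonal (inj₂ (w≡y , w≡x)) = w≡x , w≡y

≐-diagonal⇒loop : {w x y : A} → (w , w) ≐ (x , y) → x ≡ y
≐-diagonal⇒loop w≐xy = let w≡x , w≡y = ≐-diagonal w≐xy in trans (sym w≡x) w≡y

map²-≐ : {f g : A → B} → (∀ x → f x ≡ g x) → ∀ p → map² f p ≐ map² g p
map²-≐ f≗g (x , y) = inj₁ (f≗g x , f≗g y)

≐-map²⁻¹ : {f : A → B} → Injective f → ∀ {p q} → map² f p ≐ map² f q → p ≐ q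
≐-map²⁻¹ f-inj (inj₁ (a , b)) = inj₁ (f-inj _ _ a , f-inj _ _ b)
≐-map²⁻¹ f-inj (inj₂ (a , b)) = inj₂ (f-inj _ _ a , f-inj _ _ b)

Obj⇒simple : ∀ C {K : Graph ℓ} → Obj C K → IsSimple K
Obj⇒simple SiStGrphs   simple       = simple
Obj⇒simple SiLlGrphs   (simple , _) = simple
Obj⇒simple SiLlStGrphs (simple , _) = simple

strict⇒Mor : ∀ C {H K : Graph ℓ} {f : Hom H K} → IsStrict f → Mor C f
strict⇒Mor SiStGrphs   strict = strict
strict⇒Mor SiLlGrphs   strict = tt
strict⇒Mor SiLlStGrphs strict = strict

-- A vertex and a loop at it have the same incidence; these are the conditions separating them.
NoVertexLoopClash : (K : Graph ℓ) → P K → P K → Set ℓ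
NoVertexLoopClash K p q = (IsEdge K p × IsEdge K q) ⊎ IsLoopless K

∂-injective : (K : Graph ℓ) → IsSimple K → ∀ p q →
              NoVertexLoopClash K p q → ∂ K p ≐ ∂ K q → p ≡ q
∂-injective K simple (inj₁ v) (inj₁ w) _ v≐w = cong inj₁ (proj₁ (≐-diagonal v≐w))
∂-injective K simple (inj₂ d) (inj₂ e) _ d≐e = cong inj₂ (simple d e d≐e)
∂-injective K simple (inj₁ v) (inj₂ e) (inj₂ loopless) v≐e =
  ⊥-elim (loopless e (≐-diagonal⇒loop v≐e))
∂-injective K simple (inj₂ e) (inj₁ v) (inj₂ loopless) e≐v =
  ⊥-elim (loopless e (≐-diagonal⇒loop (≐-sym e≐v)))

noVertexLoopClash : ∀ C {H K : Graph ℓ} → Obj C K → (g h : Hom H K) → Mor C g → Mor C h →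
                    ∀ e → NoVertexLoopClash K (fun g (inj₂ e)) (fun h (inj₂ e))
noVertexLoopClash SiStGrphs   _             _ _ g-strict h-strict e = inj₁ (g-strict e , h-strict e)
noVertexLoopClash SiLlGrphs   (_ , loopless) _ _ _ _ _              = inj₂ loopless
noVertexLoopClash SiLlStGrphs (_ , loopless) _ _ _ _ _              = inj₂ loopless

≈-from-fV : ∀ C {H K : Graph ℓ} → Obj C K → (g h : Hom H K) → Mor C g → Mor C h →
            (∀ v → fV g v ≡ fV h v) → g ≈ h
≈-from-fV C oK g h mg mh fV≗ (inj₁ v) =
  trans (fV-ok g v) (trans (cong inj₁ (fV≗ v)) (sym (fV-ok h v)))
≈-from-fV C {H} {K} oK g h mg mh fV≗ (inj₂ e) =
  ∂-injective K (Obj⇒simple C oK) _ _ (noVertexLoopClash C oK g h mg mh e)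
    (≐-trans (incident g (inj₂ e))
      (≐-trans (map²-≐ fV≗ (ends H e)) (≐-sym (incident h (inj₂ e)))))

⊚-inj₁ : {G H K : Graph ℓ} (g : Hom H K) (f : Hom G H) → ∀ x →
         (g ⊚ f) (inj₁ x) ≡ inj₁ (fV g (fV f x))
⊚-inj₁ g f x = trans (cong (fun g) (fV-ok f x)) (fV-ok g (fV f x))

fV-⊚-cong : {G H K : Graph ℓ} (g h : Hom H K) (f f′ : Hom G H) →
            (∀ p → (g ⊚ f) p ≡ (h ⊚ f′) p) → ∀ x → fV g (fV f x) ≡ fV h (fV f′ x)
fV-⊚-cong g h f f′ eq x =
  inj₁-injective (trans (sym (⊚-inj₁ g f x)) (trans (eq (inj₁ x)) (⊚-inj₁ h f′ x)))

surjective⇒epi : ∀ C {G H : Graph ℓ} (f : Hom G H) → Surjective (fV f) → IsEpi C f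
surjective⇒epi C f surj K oK g h mg mh eq = ≈-from-fV C oK g h mg mh fV≗
  where
  fV≗ : ∀ v → fV g v ≡ fV h v
  fV≗ v with surj v
  ... | x , refl = fV-⊚-cong g h f f eq x

injective⇒mono : ∀ C {G H : Graph ℓ} → Obj C G → (f : Hom G H) → Injective (fV f) → IsMono C f
injective⇒mono C oG f inj K oK g h mg mh eq =
  ≈-from-fV C oG g h mg mh (λ v → inj _ _ (fV-⊚-cong f f g h eq v))

point : Graph ℓ
point = record { V = ⊤ ; E = ⊥ ; ends = λ () }

point-Obj : ∀ C → Obj C (point {ℓ})
point-Obj SiStGrphs   = λ ()
point-Obj SiLlGrphs   = (λ ()) , (λ ())
point-Obj SiLlStGrphs = (λ ()) , (λ ())

pick : (G : Graph ℓ) → V G → Hom point G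
pick G x = record { fun = fun′ ; fV = λ _ → x ; fV-ok = λ _ → refl ; incident = incident′ }
  where
  fun′ : P point → P G
  fun′ (inj₁ _) = inj₁ x
  incident′ : ∀ p → ∂ G (fun′ p) ≐ map² (λ _ → x) (∂ point p)
  incident′ (inj₁ _) = inj₁ (refl , refl)

pick-Mor : ∀ C {G : Graph ℓ} (x : V G) → Mor C (pick G x)
pick-Mor C x = strict⇒Mor C (λ ())

mono⇒injective : ∀ C {G H : Graph ℓ} (f : Hom G H) → IsMono C f → Injective (fV f)
mono⇒injective C {G} f mono x y fx≡fy =
  inj₁-injective
    (mono point (point-Obj C) (pick G x) (pick G y) (pick-Mor C x) (pick-Mor C y) f∘x≗f∘y (inj₁ tt))
  where
  f∘x≗f∘y : ∀ p → (f ⊚ pick G x) p ≡ (f ⊚ pick G y) p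
  f∘x≗f∘y (inj₁ _) =
    trans (⊚-inj₁ f (pick G x) tt) (trans (cong inj₁ fx≡fy) (sym (⊚-inj₁ f (pick G y) tt)))

module Doubling {H : Graph ℓ} (doubled : V H → Bool) where

  copy : Bool → V H → V H ⊎ V H
  copy true  = inj₂
  copy false = inj₁

  moved : V H → V H ⊎ V H
  moved v = copy (doubled v) v

  Undoubled : V H → Set
  Undoubled v = ¬ T (doubled v)

  moved-undoubled : ∀ v → Undoubled v → moved v ≡ inj₁ v
  moved-undoubled v with doubled v
  ... | true  = λ ¬t → ⊥-elim (¬t _)
  ... | false = λ _ → refl

  moved≡inj₁⇒undoubled : ∀ {v w} → moved v ≡ inj₁ w → Undoubled v
  moved≡inj₁⇒undoubled {v} with doubled v
  ... | true  = λ ()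
  ... | false = λ _ ()

  moved-injective : Injective moved
  moved-injective u v with doubled u | doubled v
  ... | true  | true  = inj₂-injective
  ... | false | false = inj₁-injective
  ... | true  | false = λ ()
  ... | false | true  = λ ()

  touches : E H → Bool
  touches e = doubled (proj₁ (ends H e)) ∨ doubled (proj₂ (ends H e))

  untouched : ∀ e → Undoubled (proj₁ (ends H e)) → Undoubled (proj₂ (ends H e)) → ¬ T (touches e)
  untouched e ¬a ¬b t = [ ¬a , ¬b ]′ (Equivalence.to T-∨ t)

  -- The second copy of an undoubled vertex is an isolated junk vertex; it keeps moved injective.
  doubling : Graph ℓ
  doubling = record
    { V    = V H ⊎ V H
    ; E    = E H ⊎ Σ (E H) (λ e → T (touches e))
    ; ends = λ { (inj₁ e) → map² inj₁ (ends H e) ; (inj₂ (e , _)) → map² moved (ends H e) }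
    }

  kept≐moved⇒untouched : ∀ {p} e → map² inj₁ p ≐ map² moved (ends H e) → ¬ T (touches e)
  kept≐moved⇒untouched e (inj₁ (a , b)) =
    untouched e (moved≡inj₁⇒undoubled (sym a)) (moved≡inj₁⇒undoubled (sym b))
  kept≐moved⇒untouched e (inj₂ (b , a)) =
    untouched e (moved≡inj₁⇒undoubled (sym a)) (moved≡inj₁⇒undoubled (sym b))

  doubling-simple : IsSimple H → IsSimple doubling
  doubling-simple simple (inj₁ d) (inj₁ e) d≐e =
    cong inj₁ (simple d e (≐-map²⁻¹ (λ _ _ → inj₁-injective) d≐e))
  doubling-simple simple (inj₂ (d , s)) (inj₂ (e , t)) d≐e
    with refl ← simple d e (≐-map²⁻¹ moved-injective d≐e) =
    cong (λ t → inj₂ (d , t)) (T-irrelevant s t)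
  doubling-simple simple (inj₁ d) (inj₂ (e , t)) d≐e = ⊥-elim (kept≐moved⇒untouched e d≐e t)
  doubling-simple simple (inj₂ (d , t)) (inj₁ e) d≐e = ⊥-elim (kept≐moved⇒untouched d (≐-sym d≐e) t)

  doubling-loopless : IsLoopless H → IsLoopless doubling
  doubling-loopless loopless (inj₁ e)       = loopless e ∘ inj₁-injective
  doubling-loopless loopless (inj₂ (e , _)) = loopless e ∘ moved-injective _ _

  doubling-Obj : ∀ C → Obj C H → Obj C doubling
  doubling-Obj SiStGrphs   simple              = doubling-simple simple
  doubling-Obj SiLlGrphs   (simple , loopless) = doubling-simple simple , doubling-loopless loopless
  doubling-Obj SiLlStGrphs (simple , loopless) = doubling-simple simple , doubling-loopless loopless

  keep : Hom H doubling
  keep = record { fun = fun′ ; fV = inj₁ ; fV-ok = λ _ → refl ; incident = incident′ }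
    where
    fun′ : P H → P doubling
    fun′ (inj₁ v) = inj₁ (inj₁ v)
    fun′ (inj₂ e) = inj₂ (inj₁ e)
    incident′ : ∀ p → ∂ doubling (fun′ p) ≐ map² inj₁ (∂ H p)
    incident′ (inj₁ v) = inj₁ (refl , refl)
    incident′ (inj₂ e) = inj₁ (refl , refl)

  moveEdge : (e : E H) → Dec (T (touches e)) → E doubling
  moveEdge e (yes t) = inj₂ (e , t)
  moveEdge e (no _)  = inj₁ e

  moveEdge-ends : ∀ e d → ends doubling (moveEdge e d) ≐ map² moved (ends H e)
  moveEdge-ends e (yes _) = inj₁ (refl , refl)
  moveEdge-ends e (no ¬t) =
    inj₁ ( sym (moved-undoubled _ (¬t ∘ Equivalence.from T-∨ ∘ inj₁))
         , sym (moved-undoubled _ (¬t ∘ Equivalence.from T-∨ ∘ inj₂)) )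

  move : Hom H doubling
  move = record { fun = fun′ ; fV = moved ; fV-ok = λ _ → refl ; incident = incident′ }
    where
    fun′ : P H → P doubling
    fun′ (inj₁ v) = inj₁ (moved v)
    fun′ (inj₂ e) = inj₂ (moveEdge e (T? (touches e)))
    incident′ : ∀ p → ∂ doubling (fun′ p) ≐ map² moved (∂ H p)
    incident′ (inj₁ v) = inj₁ (refl , refl)
    incident′ (inj₂ e) = moveEdge-ends e (T? (touches e))

  keep-strict : IsStrict keep
  keep-strict _ = tt

  move-strict : IsStrict move
  move-strict _ = tt

  keep≡move : ∀ p → Undoubled (proj₁ (∂ H p)) → Undoubled (proj₂ (∂ H p)) →
              fun keep p ≡ fun move p
  keep≡move (inj₁ v) ¬v _  = cong inj₁ (sym (moved-undoubled v ¬v))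
  keep≡move (inj₂ e) ¬a ¬b = cong inj₂ (keep≡moveEdge (T? (touches e)))
    where
    keep≡moveEdge : (d : Dec (T (touches e))) → inj₁ e ≡ moveEdge e d
    keep≡moveEdge (yes t) = ⊥-elim (untouched e ¬a ¬b t)
    keep≡moveEdge (no _)  = refl

≐-map²⇒image : {f : A → B} {q : B × B} (p : A × A) → q ≐ map² f p →
               (Σ A λ x → f x ≡ proj₁ q) × (Σ A λ x → f x ≡ proj₂ q)
≐-map²⇒image (x , y) (inj₁ (a , b)) = (x , sym a) , (y , sym b)
≐-map²⇒image (x , y) (inj₂ (a , b)) = (y , sym a) , (x , sym b)

epi⇒surjective : ExcludedMiddle ℓ → ∀ C {G H : Graph ℓ} → Obj C H →
                 (f : Hom G H) → IsEpi C f → Surjective (fV f)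
epi⇒surjective em C {G} {H} oH f epi y = undoubled⇒image y (moved≡inj₁⇒undoubled y-unmoved)
  where
  InImage : V H → Set _
  InImage v = Σ (V G) λ x → fV f x ≡ v

  open Doubling {H = H} (λ v → isYes (em {¬ InImage v}))

  image⇒undoubled : ∀ v → InImage v → Undoubled v
  image⇒undoubled v im doubled-v = toWitness doubled-v im

  undoubled⇒image : ∀ v → Undoubled v → InImage v
  undoubled⇒image v undoubled-v = decidable-stable em (undoubled-v ∘ fromWitness)

  keep∘f≗move∘f : ∀ p → (keep ⊚ f) p ≡ (move ⊚ f) p
  keep∘f≗move∘f p =
    let a , b = ≐-map²⇒image (∂ G p) (incident f p)
    in keep≡move (fun f p) (image⇒undoubled _ a) (image⇒undoubled _ b)

  y-unmoved : moved y ≡ inj₁ y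
  y-unmoved = sym (inj₁-injective
    (epi doubling (doubling-Obj C oH) keep move
      (strict⇒Mor C keep-strict) (strict⇒Mor C move-strict) keep∘f≗move∘f (inj₁ y)))

proposition4p2 : ∀ {ℓ : Level} → ExcludedMiddle ℓ →
    (C : Cat) {G H : Graph ℓ} → Obj C G → Obj C H →
    (f : Hom G H) → Mor C f →
    (IsEpi C f ⇔ Surjective (fV f)) × (IsMono C f ⇔ Injective (fV f))
proposition4p2 em C oG oH f _ =
  mk⇔ (epi⇒surjective em C oH f) (surjective⇒epi C f) ,
  mk⇔ (mono⇒injective C f) (injective⇒mono C oG f)
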